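{- Let $G$ be a minimal counterexample to the statement "every subcubic planar graph of girth at least $6$ satisfies $\chi_{\ell}(G^2)\le 7$"; that is, $G$ is a planar graph with maximum degree at most $3$ and girth at least $6$ with $\chi_{\ell}(G^2)>7$, while $\chi_{\ell}(H^2)\le 7$ for every proper subgraph $H$ of $G$. Then $G$ has no cycle of length $6$ which contains a vertex of degree $2$.
   Context: The square $G^2$ of a graph $G$ has vertex set $V(G)$, with two distinct vertices adjacent if their distance in $G$ is at most $2$. $\chi_{\ell}$ denotes the list chromatic number. A vertex of degree $k$ is called a $k$-vertex. -}

module Defs where

open import Data.Nat using (ℕ; zero; suc; _≤_; _<_)
open import Data.Fin using (Fin; zero; suc; toℕ; inject₁; fromℕ)
open import Data.Bool using (Bool; true; false; T)
open import Data.List using (List; length; filterᵇ; allFin)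
open import Data.List.Membership.Propositional using (_∈_)
open import Data.List.Relation.Unary.Unique.Propositional using (Unique)
open import Data.Maybe using (Maybe; just)
open import Data.Product using (Σ; ∃; ∃₂; _×_; _,_)
open import Data.Sum using (_⊎_)
open import Relation.Binary.PropositionalEquality using (_≡_; _≢_)
open import Relation.Nullary using (¬_)
open import Function.Definitions using (Injective; Surjective)

record Graph (n : ℕ) : Set where
  field
    adj    : Fin n → Fin n → Bool
    sym    : ∀ u v → adj u v ≡ adj v u
    irrefl : ∀ v → adj v v ≡ false
open Graph public

module _ {n : ℕ} (G : Graph n) where

  Edge : Fin n → Fin n → Set
  Edge u v = T (adj G u v)

  deg : Fin n → ℕ
  deg v = length (filterᵇ (adj G v) (allFin n))

  MaxDegreeAtMost : ℕ → Set
  MaxDegreeAtMost d = ∀ v → deg v ≤ d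

  -- A cycle of length (suc m): an injective closed walk
  -- c 0 ~ c 1 ~ ... ~ c m ~ c 0.
  record Cycle (m : ℕ) : Set where
    field
      vtx       : Fin (suc m) → Fin n
      injective : Injective _≡_ _≡_ vtx
      step      : ∀ (i : Fin m) → Edge (vtx (inject₁ i)) (vtx (suc i))
      close     : Edge (vtx (fromℕ m)) (vtx zero)
  open Cycle public

  GirthAtLeast6 : Set
  GirthAtLeast6 = ∀ m → 2 ≤ m → m ≤ 4 → ¬ Cycle m

  SqAdj : Fin n → Fin n → Set
  SqAdj u v = u ≢ v × (Edge u v ⊎ ∃ λ w → Edge u w × Edge w v)

  data WalkIn (P : Fin n → Set) : Fin n → Fin n → Set where
    here : ∀ {u} → P u → WalkIn P u u
    cons : ∀ {u w v} → P u → Edge u w → WalkIn P w v → WalkIn P u v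

  -- G has a minor of the "pattern" R on h vertices: branch sets given by a
  -- partial map br, nonempty, connected, and adjacent whenever R holds.
  HasMinor : (h : ℕ) → (Fin h → Fin h → Set) → Set
  HasMinor h R =
    Σ (Fin n → Maybe (Fin h)) λ br →
      (∀ i → ∃ λ v → br v ≡ just i) ×
      (∀ i u v → br u ≡ just i → br v ≡ just i → WalkIn (λ w → br w ≡ just i) u v) ×
      (∀ i j → R i j → ∃₂ λ u v → br u ≡ just i × br v ≡ just j × Edge u v)

K5 : Fin 5 → Fin 5 → Set
K5 i j = i ≢ j

K33 : Fin 6 → Fin 6 → Set
K33 i j = toℕ i < 3 × 3 ≤ toℕ j

-- planarity via Wagner's theorem: no K₅ minor and no K₃,₃ minor
Planar : ∀ {n} → Graph n → Set
Planar G = ¬ HasMinor G 5 K5 × ¬ HasMinor G 6 K33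

Choosable : ∀ {n} → (Fin n → Fin n → Set) → ℕ → Set
Choosable {n} R k =
  ∀ (L : Fin n → List ℕ) → (∀ v → Unique (L v) × k ≤ length (L v)) →
  Σ (Fin n → ℕ) λ c → (∀ v → c v ∈ L v) × (∀ u v → R u v → c u ≢ c v)

SquareChoosable : ∀ {n} → Graph n → ℕ → Set
SquareChoosable G k = Choosable (SqAdj G) k

-- H is a proper subgraph of G (via an injective edge-preserving vertex map,
-- which is not simultaneously surjective on vertices and on edges)
ProperSubgraph : ∀ {m n} → Graph m → Graph n → Set
ProperSubgraph {m} {n} H G =
  Σ (Fin m → Fin n) λ f →
    Injective _≡_ _≡_ f ×
    (∀ u v → Edge H u v → Edge G (f u) (f v)) ×
    ¬ (Surjective _≡_ _≡_ f × (∀ u v → Edge G (f u) (f v) → Edge H u v))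

-- Let v₀ be the 2-vertex on the 6-cycle v₀ v₁ … v₅. Deleting the two edges at v₀ leaves a
-- proper subgraph, so by minimality its square has a colouring φ from any lists of 7 colours.
-- Keep φ off the hexagon and recolour v₀, …, v₅. As G is subcubic and deg v₀ = 2, these
-- vertices see at most 2, 4, 5, 5, 5, 4 vertices off the hexagon within distance 2, so they
-- keep at least 5, 3, 2, 2, 2, 3 usable colours; by girth ≥ 6 the square of G induces the
-- square of C₆ on the hexagon. There v₁, …, v₅ span a wheel with hub v₃ and rim v₁ v₂ v₄ v₅,
-- on which φ is proper except possibly on the rim edge v₁v₅ (the path v₁ v₀ v₅ was cut), and
-- a short case analysis on the lists repairs that edge. Finally v₀ has five usable colours
-- against four coloured neighbours.

module Submission where

open import Defs
open import Data.Nat using (ℕ)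
open import Relation.Binary.PropositionalEquality using (_≢_)
open import Relation.Nullary using (¬_)

open import Data.Bool using (T; _∧_)
open import Data.Bool.Properties using (∧-comm; T-∧)
open import Data.Empty using (⊥)
open import Data.Fin using (Fin; zero; suc; inject₁; fromℕ)
open import Data.Fin.Patterns using (0F; 1F; 2F; 3F; 4F; 5F)
open import Data.Fin.Properties using (_≟_; any?; all?)
open import Data.List using (List; []; _∷_; _++_; length; map; filter; filterᵇ; allFin; concatMap)
open import Data.List.Properties using (length-++; length-map; length-filter; filter-++; filter-none)
open import Data.List.Membership.Propositional using (_∈_; _∉_)
open import Data.List.Membership.Propositional.Properties
  using (∈-∃++; ∈-++⁺ˡ; ∈-++⁺ʳ; ∈-filter⁺; ∈-filter⁻; ∈-allFin; ∈-concat⁺′; ∈-concat⁻′; ∈-map⁺; ∈-map⁻)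
open import Data.List.Relation.Unary.All as All using (All; []; _∷_)
open import Data.List.Relation.Unary.AllPairs using (_∷_)
open import Data.List.Relation.Unary.Any using (here; there)
open import Data.List.Relation.Unary.Unique.Propositional using (Unique)
open import Data.List.Relation.Binary.Permutation.Propositional using (_↭_; prep; swap; ↭-refl; ↭-sym; ↭-trans)
open import Data.List.Relation.Binary.Permutation.Propositional.Properties
  using (shift; ∈-resp-↭; ↭-length; filter-↭; map⁺)
open import Data.Nat using (suc; _+_; _*_; _≤_; _<_; z≤n; s≤s; s≤s⁻¹)
open import Data.Nat.ListAction using (sum)
open import Data.Nat.ListAction.Properties using (sum-↭)
import Data.Nat.Properties as ℕ
open import Data.Nat.Properties
  using (≤-refl; ≤-trans; ≤-reflexive; +-assoc; +-comm; +-cancelˡ-≤; +-mono-≤; +-monoˡ-≤; +-monoʳ-≤;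
         +-monoʳ-<; *-monoʳ-≤; module ≤-Reasoning)
open import Data.Nat.Solver using (module +-*-Solver)
open import Data.Product using (Σ; ∃; _×_; _,_; proj₁; proj₂)
open import Data.Sum using (_⊎_; inj₁; inj₂)
open import Data.Vec using (Vec; []; _∷_; lookup)
open import Data.Vec.Relation.Unary.AllPairs using ([]; _∷_)
open import Data.Vec.Relation.Unary.All using ([]; _∷_)
open import Data.Vec.Relation.Unary.Linked using (Linked; [-]; _∷_)
import Data.Vec.Relation.Unary.Unique.Propositional as Vec
open import Data.Vec.Relation.Unary.Unique.Propositional.Properties using (lookup-injective)
open import Function using (_∘_; id; Equivalence)
open import Function.Definitions using (Injective)
open import Relation.Binary.Definitions using (DecidableEquality)
open import Relation.Binary.PropositionalEquality as ≡ using (_≡_; refl; trans; cong; cong₂; subst; ≢-sym)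
open import Relation.Nullary using (Dec; yes; no; contradiction)
open import Relation.Nullary.Decidable using (T?; isNo; toWitnessFalse; fromWitnessFalse; from-yes; ¬?; _→-dec_; _⊎-dec_)
open import Relation.Unary using (Decidable; ∁)

module _ {A : Set} where

  ∈⇒↭∷ : ∀ {x : A} {xs} → x ∈ xs → ∃ λ ys → xs ↭ x ∷ ys
  ∈⇒↭∷ x∈xs with ys , zs , refl ← ∈-∃++ x∈xs = ys ++ zs , shift _ ys zs

  ∈∈⇒↭∷∷ : ∀ {x y : A} {xs} → x ∈ xs → y ∈ xs → x ≢ y → ∃ λ zs → xs ↭ x ∷ y ∷ zs
  ∈∈⇒↭∷∷ x∈xs y∈xs x≢y with ys , xs↭ ← ∈⇒↭∷ x∈xs with ∈-resp-↭ xs↭ y∈xs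
  ... | here y≡x = contradiction (≡.sym y≡x) x≢y
  ... | there y∈ys with zs , ys↭ ← ∈⇒↭∷ y∈ys = zs , ↭-trans xs↭ (prep _ ys↭)

module _ {A : Set} {P : A → Set} (P? : Decidable P) where

  length-filter-↭ : ∀ {xs ys zs} → xs ↭ ys ++ zs → All (∁ P) ys → length (filter P? xs) ≤ length zs
  length-filter-↭ {xs} {ys} {zs} xs↭ys++zs ¬Pys = begin
    length (filter P? xs)                  ≡⟨ ↭-length (filter-↭ P? xs↭ys++zs) ⟩
    length (filter P? (ys ++ zs))          ≡⟨ cong length (filter-++ P? ys zs) ⟩
    length (filter P? ys ++ filter P? zs)  ≡⟨ cong (λ l → length (l ++ filter P? zs)) (filter-none P? ¬Pys) ⟩
    length (filter P? zs)                  ≤⟨ length-filter P? zs ⟩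
    length zs                              ∎
    where open ≤-Reasoning

module _ {A B : Set} (f : A → List B) where

  length-concatMap : ∀ xs → length (concatMap f xs) ≡ sum (map (length ∘ f) xs)
  length-concatMap [] = refl
  length-concatMap (x ∷ xs) = trans (length-++ (f x)) (cong (length (f x) +_) (length-concatMap xs))

  length-concatMap-≤ : ∀ {k} xs → (∀ {x} → x ∈ xs → length (f x) ≤ k) → length (concatMap f xs) ≤ length xs * k
  length-concatMap-≤ [] _ = z≤n
  length-concatMap-≤ {k} (x ∷ xs) bound =
    subst (_≤ length (x ∷ xs) * k) (≡.sym (length-++ (f x)))
      (+-mono-≤ (bound (here refl)) (length-concatMap-≤ xs (bound ∘ there)))

  length-concatMap-↭ : ∀ {xs ys} → xs ↭ ys → length (concatMap f xs) ≡ length (concatMap f ys)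
  length-concatMap-↭ {xs} {ys} xs↭ys = begin
    length (concatMap f xs)      ≡⟨ length-concatMap xs ⟩
    sum (map (length ∘ f) xs)    ≡⟨ sum-↭ (map⁺ (length ∘ f) xs↭ys) ⟩
    sum (map (length ∘ f) ys)    ≡⟨ length-concatMap ys ⟨
    length (concatMap f ys)      ∎
    where open ≡.≡-Reasoning

lookup-linked : ∀ {A : Set} {R : A → A → Set} {m} {xs : Vec A (suc m)} →
                Linked R xs → ∀ i → R (lookup xs (inject₁ i)) (lookup xs (suc i))
lookup-linked {xs = _ ∷ _ ∷ _} (r ∷ _) zero = r
lookup-linked {xs = _ ∷ _ ∷ _} (_ ∷ rs) (suc i) = lookup-linked rs i

next : Fin 6 → Fin 6
next 0F = 1F
next 1F = 2F
next 2F = 3F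
next 3F = 4F
next 4F = 5F
next 5F = 0F

prev : Fin 6 → Fin 6
prev 0F = 5F
prev 1F = 0F
prev 2F = 1F
prev 3F = 2F
prev 4F = 3F
prev 5F = 4F

antipode : Fin 6 → Fin 6
antipode k = next (next (next k))

Near : Fin 6 → Fin 6 → Set
Near i j = j ≡ next i ⊎ j ≡ next (next i)

next-injective : Injective _≡_ _≡_ next
next-injective {i} {j} = from-yes (all? λ k → all? λ l → (next k ≟ next l) →-dec (k ≟ l)) i j

next-prev : ∀ k → next (prev k) ≡ k
next-prev = from-yes (all? λ k → next (prev k) ≟ k)

prev≢next : ∀ k → prev k ≢ next k
prev≢next = from-yes (all? λ k → ¬? (prev k ≟ next k))

≢-next² : ∀ k → k ≢ next (next k)
≢-next² = from-yes (all? λ k → ¬? (k ≟ next (next k)))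

near-or-antipodal : ∀ i j → i ≢ j → j ≢ antipode i → Near i j ⊎ Near j i
near-or-antipodal = from-yes (all? λ i → all? λ j →
  ¬? (i ≟ j) →-dec ¬? (j ≟ antipode i) →-dec
    (((j ≟ next i) ⊎-dec (j ≟ next (next i))) ⊎-dec ((i ≟ next j) ⊎-dec (i ≟ next (next j)))))

module ListColouring {C : Set} (_≟_ : DecidableEquality C) where

  open import Data.List.Membership.DecPropositional _≟_ using (_∈?_)

  Unique⇒∃∉ : ∀ {xs ys : List C} → Unique xs → length ys < length xs → ∃ λ x → x ∈ xs × x ∉ ys
  Unique⇒∃∉ {x ∷ xs} {ys} (x∉xs ∷ !xs) |ys|<|x∷xs| with x ∈? ys
  ... | no x∉ys = x , here refl , x∉ys
  ... | yes x∈ys with zs , ys↭ ← ∈⇒↭∷ x∈ys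
                 with y , y∈xs , y∉zs ← Unique⇒∃∉ !xs
                          (s≤s⁻¹ (subst (_< suc (length xs)) (↭-length ys↭) |ys|<|x∷xs|))
    = y , there y∈xs , y∉ys
    where
    y∉ys : y ∉ ys
    y∉ys y∈ys with ∈-resp-↭ ys↭ y∈ys
    ... | here y≡x = All.lookup x∉xs y∈xs (≡.sym y≡x)
    ... | there y∈zs = y∉zs y∈zs

  -- A has at least k elements, read constructively: any k - 1 values can be avoided.
  AtLeast : ℕ → (C → Set) → Set
  AtLeast k A = ∀ (F : List C) → length F < k → ∃ λ x → A x × x ∉ F

  atLeast-∈∉ : ∀ {xs : List C} (B : List C) {k} → Unique xs → length B + k ≤ length xs →
              AtLeast k (λ x → x ∈ xs × x ∉ B)
  atLeast-∈∉ B !xs |B|+k≤|xs| F |F|<k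
    with x , x∈xs , x∉B++F ← Unique⇒∃∉ {ys = B ++ F} !xs (let open ≤-Reasoning in begin-strict
           length (B ++ F)      ≡⟨ length-++ B ⟩
           length B + length F  <⟨ +-monoʳ-< (length B) |F|<k ⟩
           length B + _         ≤⟨ |B|+k≤|xs| ⟩
           _                    ∎)
    = x , (x∈xs , x∉B++F ∘ ∈-++⁺ˡ) , x∉B++F ∘ ∈-++⁺ʳ B

  avoid₁ : ∀ {A} → AtLeast 2 A → ∀ y → ∃ λ x → A x × x ≢ y
  avoid₁ |A| y with x , x∈A , x∉ ← |A| (y ∷ []) ≤-refl = x , x∈A , x∉ ∘ here

  avoid₂ : ∀ {A} → AtLeast 3 A → ∀ y z → ∃ λ x → A x × x ≢ y × x ≢ z
  avoid₂ |A| y z with x , x∈A , x∉ ← |A| (y ∷ z ∷ []) ≤-refl = x , x∈A , x∉ ∘ here , x∉ ∘ there ∘ here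

  avoid₄ : ∀ {A} → AtLeast 5 A → ∀ y₁ y₂ y₃ y₄ → ∃ λ x → A x × x ≢ y₁ × x ≢ y₂ × x ≢ y₃ × x ≢ y₄
  avoid₄ |A| y₁ y₂ y₃ y₄ with x , x∈A , x∉ ← |A| (y₁ ∷ y₂ ∷ y₃ ∷ y₄ ∷ []) ≤-refl =
    x , x∈A , x∉ ∘ here , x∉ ∘ there ∘ here , x∉ ∘ there ∘ there ∘ here ,
    x∉ ∘ there ∘ there ∘ there ∘ here

  module Wheel {A₁ A₂ A₃ A₄ A₅ : C → Set} (|A₁| : AtLeast 3 A₁) (|A₂| : AtLeast 2 A₂)
               (|A₃| : AtLeast 2 A₃) (|A₄| : AtLeast 2 A₄) (|A₅| : AtLeast 3 A₅) where

    -- the wheel with hub 3 and rim cycle 1 2 4 5, i.e. the square of the 6-cycle 0 … 5 minus 0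
    record Colouring : Set where
      constructor colouring
      field
        {c₁ c₂ c₃ c₄ c₅} : C
        c₁∈ : A₁ c₁
        c₂∈ : A₂ c₂
        c₃∈ : A₃ c₃
        c₄∈ : A₄ c₄
        c₅∈ : A₅ c₅
        c₁≢c₂ : c₁ ≢ c₂
        c₁≢c₃ : c₁ ≢ c₃
        c₁≢c₅ : c₁ ≢ c₅
        c₂≢c₃ : c₂ ≢ c₃
        c₂≢c₄ : c₂ ≢ c₄
        c₃≢c₄ : c₃ ≢ c₄
        c₃≢c₅ : c₃ ≢ c₅
        c₄≢c₅ : c₄ ≢ c₅

    -- the colours c a b d c on 1 2 3 4 5, proper except on the rim edge 15
    module Clash {a b c d} (c∈A₁ : A₁ c) (a∈A₂ : A₂ a) (b∈A₃ : A₃ b) (d∈A₄ : A₄ d) (c∈A₅ : A₅ c)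
                 (a≢b : a ≢ b) (a≢d : a ≢ d) (b≢d : b ≢ d) (c≢a : c ≢ a) (c≢b : c ≢ b) (c≢d : c ≢ d) where

      recolour₁ : ∀ {x} → A₁ x → x ≢ a → x ≢ b → x ≢ c → Colouring
      recolour₁ x∈A₁ x≢a x≢b x≢c =
        colouring x∈A₁ a∈A₂ b∈A₃ d∈A₄ c∈A₅ x≢a x≢b x≢c a≢b a≢d b≢d (≢-sym c≢b) (≢-sym c≢d)

      recolour₅ : ∀ {x} → A₅ x → x ≢ b → x ≢ c → x ≢ d → Colouring
      recolour₅ x∈A₅ x≢b x≢c x≢d =
        colouring c∈A₁ a∈A₂ b∈A₃ d∈A₄ x∈A₅ c≢a c≢b (≢-sym x≢c) a≢b a≢d b≢d (≢-sym x≢b) (≢-sym x≢d)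

      recolour₁-or-stuck : Colouring ⊎ (A₁ a × A₁ b)
      recolour₁-or-stuck with avoid₂ |A₁| b c
      ... | x , x∈A₁ , x≢b , x≢c with x ≟ a
      ...   | no x≢a = inj₁ (recolour₁ x∈A₁ x≢a x≢b x≢c)
      ...   | yes x≡a with avoid₂ |A₁| a c
      ...     | y , y∈A₁ , y≢a , y≢c with y ≟ b
      ...       | no y≢b = inj₁ (recolour₁ y∈A₁ y≢a y≢b y≢c)
      ...       | yes y≡b = inj₂ (subst A₁ x≡a x∈A₁ , subst A₁ y≡b y∈A₁)

      recolour₅-or-stuck : Colouring ⊎ (A₅ d × A₅ b)
      recolour₅-or-stuck with avoid₂ |A₅| b c
      ... | x , x∈A₅ , x≢b , x≢c with x ≟ d
      ...   | no x≢d = inj₁ (recolour₅ x∈A₅ x≢b x≢c x≢d)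
      ...   | yes x≡d with avoid₂ |A₅| d c
      ...     | y , y∈A₅ , y≢d , y≢c with y ≟ b
      ...       | no y≢b = inj₁ (recolour₅ y∈A₅ y≢b y≢c y≢d)
      ...       | yes y≡b = inj₂ (subst A₅ x≡d x∈A₅ , subst A₅ y≡b y∈A₅)

      -- Here A₁ ⊇ {a, b, c} and A₅ ⊇ {b, c, d}, so neither end of the rim edge can be recoloured
      -- alone; a second colour from each of A₂, A₃, A₄ always suffices.
      stuck : A₁ a → A₁ b → A₅ b → A₅ d → Colouring
      stuck a∈A₁ b∈A₁ b∈A₅ d∈A₅
        with a' , a'∈A₂ , a'≢a ← avoid₁ |A₂| a
        with b' , b'∈A₃ , b'≢b ← avoid₁ |A₃| b
        with d' , d'∈A₄ , d'≢d ← avoid₁ |A₄| d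
        with a' ≟ c | d' ≟ c | a' ≟ d | d' ≟ a | b' ≟ a | b' ≟ c | b' ≟ d
      ... | yes a'≡c | _ | _ | _ | _ | _ | _ =
        colouring a∈A₁ (subst A₂ a'≡c a'∈A₂) b∈A₃ d∈A₄ c∈A₅
          (≢-sym c≢a) a≢b (≢-sym c≢a) c≢b c≢d b≢d (≢-sym c≢b) (≢-sym c≢d)
      ... | no _ | yes d'≡c | _ | _ | _ | _ | _ =
        colouring c∈A₁ a∈A₂ b∈A₃ (subst A₄ d'≡c d'∈A₄) d∈A₅
          c≢a c≢b c≢d a≢b (≢-sym c≢a) (≢-sym c≢b) b≢d c≢d
      ... | no _ | no _ | yes a'≡d | yes d'≡a | _ | _ | _ =
        colouring a∈A₁ (subst A₂ a'≡d a'∈A₂) b∈A₃ (subst A₄ d'≡a d'∈A₄) c∈A₅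
          a≢d a≢b (≢-sym c≢a) (≢-sym b≢d) (≢-sym a≢d) (≢-sym a≢b) (≢-sym c≢b) (≢-sym c≢a)
      ... | no a'≢c | no d'≢c | _ | _ | no b'≢a | no b'≢c | no b'≢d =
        colouring b∈A₁ a∈A₂ b'∈A₃ d∈A₄ c∈A₅
          (≢-sym a≢b) (≢-sym b'≢b) (≢-sym c≢b) (≢-sym b'≢a) a≢d b'≢d b'≢c (≢-sym c≢d)
      ... | no a'≢c | no d'≢c | no a'≢d | _ | yes b'≡a | _ | _ =
        colouring c∈A₁ a'∈A₂ (subst A₃ b'≡a b'∈A₃) d∈A₄ b∈A₅
          (≢-sym a'≢c) c≢a c≢b a'≢a a'≢d a≢d a≢b (≢-sym b≢d)
      ... | no a'≢c | no d'≢c | yes a'≡d | no d'≢a | yes b'≡a | _ | _ =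
        colouring b∈A₁ (subst A₂ a'≡d a'∈A₂) (subst A₃ b'≡a b'∈A₃) d'∈A₄ c∈A₅
          b≢d (≢-sym a≢b) (≢-sym c≢b) (≢-sym a≢d) (≢-sym d'≢d) (≢-sym d'≢a) (≢-sym c≢a) d'≢c
      ... | no a'≢c | no d'≢c | no a'≢d | _ | no _ | yes b'≡c | _ =
        colouring a∈A₁ a'∈A₂ (subst A₃ b'≡c b'∈A₃) d∈A₄ b∈A₅
          (≢-sym a'≢a) (≢-sym c≢a) a≢b a'≢c a'≢d c≢d c≢b (≢-sym b≢d)
      ... | no a'≢c | no d'≢c | _ | no d'≢a | no _ | yes b'≡c | _ =
        colouring b∈A₁ a∈A₂ (subst A₃ b'≡c b'∈A₃) d'∈A₄ d∈A₅
          (≢-sym a≢b) (≢-sym c≢b) b≢d (≢-sym c≢a) (≢-sym d'≢a) (≢-sym d'≢c) c≢d d'≢d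
      ... | no a'≢c | no d'≢c | _ | no d'≢a | no _ | no _ | yes b'≡d =
        colouring b∈A₁ a∈A₂ (subst A₃ b'≡d b'∈A₃) d'∈A₄ c∈A₅
          (≢-sym a≢b) b≢d (≢-sym c≢b) a≢d (≢-sym d'≢a) (≢-sym d'≢d) (≢-sym c≢d) d'≢c
      ... | no a'≢c | no d'≢c | no a'≢d | yes d'≡a | no _ | no _ | yes b'≡d =
        colouring c∈A₁ a'∈A₂ (subst A₃ b'≡d b'∈A₃) (subst A₄ d'≡a d'∈A₄) b∈A₅
          (≢-sym a'≢c) c≢d c≢b a'≢d a'≢a (≢-sym a≢d) (≢-sym b≢d) a≢b

      clash : Colouring
      clash with recolour₁-or-stuck | recolour₅-or-stuck
      ... | inj₁ κ | _ = κ
      ... | inj₂ _ | inj₁ κ = κ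
      ... | inj₂ (a∈A₁ , b∈A₁) | inj₂ (d∈A₅ , b∈A₅) = stuck a∈A₁ b∈A₁ b∈A₅ d∈A₅

    colour-wheel : ∀ {p₁ p₂ p₃ p₄ p₅} → A₁ p₁ → A₂ p₂ → A₃ p₃ → A₄ p₄ → A₅ p₅ →
                   p₁ ≢ p₂ → p₁ ≢ p₃ → p₂ ≢ p₃ → p₂ ≢ p₄ → p₃ ≢ p₄ → p₃ ≢ p₅ → p₄ ≢ p₅ → Colouring
    colour-wheel {p₁} {p₅ = p₅} p₁∈ p₂∈ p₃∈ p₄∈ p₅∈ p₁≢p₂ p₁≢p₃ p₂≢p₃ p₂≢p₄ p₃≢p₄ p₃≢p₅ p₄≢p₅
      with p₁ ≟ p₅
    ... | no p₁≢p₅ =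
      colouring p₁∈ p₂∈ p₃∈ p₄∈ p₅∈ p₁≢p₂ p₁≢p₃ p₁≢p₅ p₂≢p₃ p₂≢p₄ p₃≢p₄ p₃≢p₅ p₄≢p₅
    ... | yes refl =
      Clash.clash p₁∈ p₂∈ p₃∈ p₄∈ p₅∈ p₂≢p₃ p₂≢p₄ p₃≢p₄ p₁≢p₂ p₁≢p₃ (≢-sym p₄≢p₅)

  record HexagonColouring (A : Fin 6 → C → Set) : Set where
    field
      colour       : Fin 6 → C
      colour∈      : ∀ k → A k (colour k)
      colour≢next  : ∀ k → colour k ≢ colour (next k)
      colour≢next² : ∀ k → colour k ≢ colour (next (next k))

  colour-hexagon : ∀ {A : Fin 6 → C → Set} →
    AtLeast 5 (A 0F) → AtLeast 3 (A 1F) → AtLeast 2 (A 2F) →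
    AtLeast 2 (A 3F) → AtLeast 2 (A 4F) → AtLeast 3 (A 5F) →
    (p : Fin 6 → C) → (∀ k → k ≢ 0F → A k (p k)) →
    (∀ k → k ≢ 0F → next k ≢ 0F → p k ≢ p (next k)) →
    (∀ k → k ≢ 0F → next k ≢ 0F → next (next k) ≢ 0F → p k ≢ p (next (next k))) →
    HexagonColouring A
  colour-hexagon {A} |A₀| |A₁| |A₂| |A₃| |A₄| |A₅| p p∈A p≢p∘next p≢p∘next² =
    extend (avoid₄ |A₀| c₁ c₂ c₄ c₅)
    where
    open Wheel |A₁| |A₂| |A₃| |A₄| |A₅|
    open Colouring (colour-wheel (p∈A 1F λ ()) (p∈A 2F λ ()) (p∈A 3F λ ()) (p∈A 4F λ ()) (p∈A 5F λ ())
      (p≢p∘next 1F (λ ()) (λ ())) (p≢p∘next² 1F (λ ()) (λ ()) (λ ()))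
      (p≢p∘next 2F (λ ()) (λ ())) (p≢p∘next² 2F (λ ()) (λ ()) (λ ()))
      (p≢p∘next 3F (λ ()) (λ ())) (p≢p∘next² 3F (λ ()) (λ ()) (λ ()))
      (p≢p∘next 4F (λ ()) (λ ())))

    extend : (∃ λ c₀ → A 0F c₀ × c₀ ≢ c₁ × c₀ ≢ c₂ × c₀ ≢ c₄ × c₀ ≢ c₅) → HexagonColouring A
    extend (c₀ , c₀∈ , c₀≢c₁ , c₀≢c₂ , c₀≢c₄ , c₀≢c₅) =
      record { colour = c ; colour∈ = c∈A ; colour≢next = c≢c∘next ; colour≢next² = c≢c∘next² }
      where
      c : Fin 6 → C
      c 0F = c₀
      c 1F = c₁
      c 2F = c₂
      c 3F = c₃
      c 4F = c₄
      c 5F = c₅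

      c∈A : ∀ k → A k (c k)
      c∈A 0F = c₀∈
      c∈A 1F = c₁∈
      c∈A 2F = c₂∈
      c∈A 3F = c₃∈
      c∈A 4F = c₄∈
      c∈A 5F = c₅∈

      c≢c∘next : ∀ k → c k ≢ c (next k)
      c≢c∘next 0F = c₀≢c₁
      c≢c∘next 1F = c₁≢c₂
      c≢c∘next 2F = c₂≢c₃
      c≢c∘next 3F = c₃≢c₄
      c≢c∘next 4F = c₄≢c₅
      c≢c∘next 5F = ≢-sym c₀≢c₅

      c≢c∘next² : ∀ k → c k ≢ c (next (next k))
      c≢c∘next² 0F = c₀≢c₂
      c≢c∘next² 1F = c₁≢c₃
      c≢c∘next² 2F = c₂≢c₄
      c≢c∘next² 3F = c₃≢c₅
      c≢c∘next² 4F = ≢-sym c₀≢c₄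
      c≢c∘next² 5F = ≢-sym c₁≢c₅

-- G without the edges at x: a proper subgraph on the same vertex set, so no renumbering is needed.
isolate : ∀ {n} → Graph n → Fin n → Graph n
isolate G x = record
  { adj    = λ u w → adj G u w ∧ (isNo (x ≟ u) ∧ isNo (x ≟ w))
  ; sym    = λ u w → cong₂ _∧_ (Graph.sym G u w) (∧-comm (isNo (x ≟ u)) (isNo (x ≟ w)))
  ; irrefl = λ u → cong (_∧ _) (irrefl G u)
  }

module GraphProperties {n} (G : Graph n) where

  edge-sym : ∀ {a b} → Edge G a b → Edge G b a
  edge-sym {a} {b} = subst T (Graph.sym G a b)

  edge⇒≢ : ∀ {a b} → Edge G a b → a ≢ b
  edge⇒≢ {a} e refl = subst T (irrefl G a) e

  sqAdj-sym : ∀ {a b} → SqAdj G a b → SqAdj G b a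
  sqAdj-sym (a≢b , inj₁ ab) = ≢-sym a≢b , inj₁ (edge-sym ab)
  sqAdj-sym (a≢b , inj₂ (m , am , mb)) = ≢-sym a≢b , inj₂ (m , edge-sym mb , edge-sym am)

  neighbours : Fin n → List (Fin n)
  neighbours x = filterᵇ (adj G x) (allFin n)

  ∈-neighbours : ∀ {x y} → Edge G x y → y ∈ neighbours x
  ∈-neighbours {x} {y} = ∈-filter⁺ (T? ∘ adj G x) (∈-allFin y)

  neighbours⇒edge : ∀ {x y} → y ∈ neighbours x → Edge G x y
  neighbours⇒edge {x} y∈ = proj₂ (∈-filter⁻ (T? ∘ adj G x) {xs = allFin n} y∈)

  neighbours-↭ : ∀ {x a b} → Edge G x a → Edge G x b → a ≢ b → ∃ λ rest → neighbours x ↭ a ∷ b ∷ rest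
  neighbours-↭ xa xb = ∈∈⇒↭∷∷ (∈-neighbours xa) (∈-neighbours xb)

  degree-2-neighbours : ∀ {x a b z} → deg G x ≡ 2 → Edge G x a → Edge G x b → a ≢ b → Edge G x z → z ≡ a ⊎ z ≡ b
  degree-2-neighbours d≡2 xa xb a≢b xz with neighbours-↭ xa xb a≢b
  ... | _ ∷ _ , nbrs↭ = contradiction (trans (≡.sym (↭-length nbrs↭)) d≡2) λ ()
  ... | [] , nbrs↭ with ∈-resp-↭ nbrs↭ (∈-neighbours xz)
  ...   | here z≡a = inj₁ z≡a
  ...   | there (here z≡b) = inj₂ z≡b

  cycle : ∀ {m} (xs : Vec (Fin n) (suc m)) → Vec.Unique xs → Linked (Edge G) xs →
          Edge G (lookup xs (fromℕ m)) (lookup xs zero) → Cycle G m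
  cycle xs !xs linked closing = record
    { vtx = lookup xs ; injective = lookup-injective !xs _ _ ; step = lookup-linked linked ; close = closing }

  module _ (girth : GirthAtLeast6 G) where

    no-triangle : ∀ {a b c} → Edge G a b → Edge G b c → Edge G c a → ⊥
    no-triangle ab bc ca = girth 2 ≤-refl (s≤s (s≤s z≤n))
      (cycle (_ ∷ _ ∷ _ ∷ [])
        ((edge⇒≢ ab ∷ ≢-sym (edge⇒≢ ca) ∷ []) ∷ (edge⇒≢ bc ∷ []) ∷ [] ∷ [])
        (ab ∷ bc ∷ [-]) ca)

    no-square : ∀ {a b c d} → a ≢ c → b ≢ d → Edge G a b → Edge G b c → Edge G c d → Edge G d a → ⊥
    no-square a≢c b≢d ab bc cd da = girth 3 (s≤s (s≤s z≤n)) (s≤s (s≤s (s≤s z≤n)))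
      (cycle (_ ∷ _ ∷ _ ∷ _ ∷ [])
        ((edge⇒≢ ab ∷ a≢c ∷ ≢-sym (edge⇒≢ da) ∷ []) ∷ (edge⇒≢ bc ∷ b≢d ∷ []) ∷ (edge⇒≢ cd ∷ []) ∷ [] ∷ [])
        (ab ∷ bc ∷ cd ∷ [-]) da)

    no-pentagon : ∀ {a b c d e} → a ≢ c → a ≢ d → b ≢ d → b ≢ e → c ≢ e →
                  Edge G a b → Edge G b c → Edge G c d → Edge G d e → Edge G e a → ⊥
    no-pentagon a≢c a≢d b≢d b≢e c≢e ab bc cd de ea = girth 4 (s≤s (s≤s z≤n)) ≤-refl
      (cycle (_ ∷ _ ∷ _ ∷ _ ∷ _ ∷ [])
        ((edge⇒≢ ab ∷ a≢c ∷ a≢d ∷ ≢-sym (edge⇒≢ ea) ∷ []) ∷ (edge⇒≢ bc ∷ b≢d ∷ b≢e ∷ []) ∷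
         (edge⇒≢ cd ∷ c≢e ∷ []) ∷ (edge⇒≢ de ∷ []) ∷ [] ∷ [])
        (ab ∷ bc ∷ cd ∷ de ∷ [-]) ea)

    path₃-¬sqAdj : ∀ {x₀ x₁ x₂ x₃} → x₀ ≢ x₂ → x₁ ≢ x₃ →
                   Edge G x₀ x₁ → Edge G x₁ x₂ → Edge G x₂ x₃ → ¬ SqAdj G x₀ x₃
    path₃-¬sqAdj x₀≢x₂ x₁≢x₃ e₀₁ e₁₂ e₂₃ (_ , inj₁ e₀₃) = no-square x₀≢x₂ x₁≢x₃ e₀₁ e₁₂ e₂₃ (edge-sym e₀₃)
    path₃-¬sqAdj {x₀} {x₁} {x₂} x₀≢x₂ x₁≢x₃ e₀₁ e₁₂ e₂₃ (x₀≢x₃ , inj₂ (w , e₀w , ew₃))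
      with w ≟ x₁ | w ≟ x₂
    ... | yes refl | _ = no-triangle e₁₂ e₂₃ (edge-sym ew₃)
    ... | no _ | yes refl = no-triangle e₀₁ e₁₂ (edge-sym e₀w)
    ... | no w≢x₁ | no w≢x₂ =
      no-pentagon x₀≢x₂ x₀≢x₃ x₁≢x₃ (≢-sym w≢x₁) (≢-sym w≢x₂) e₀₁ e₁₂ e₂₃ (edge-sym ew₃) (edge-sym e₀w)

  module _ {x : Fin n} where

    edge-isolate : ∀ {u w} → x ≢ u → x ≢ w → Edge G u w → Edge (isolate G x) u w
    edge-isolate {u} {w} x≢u x≢w uw = Equivalence.from T-∧ (uw , Equivalence.from (T-∧ {isNo (x ≟ u)})
      (fromWitnessFalse {a? = x ≟ u} x≢u , fromWitnessFalse {a? = x ≟ w} x≢w))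

    isolate-edge⁻ : ∀ {u w} → Edge (isolate G x) u w → Edge G u w × x ≢ u × x ≢ w
    isolate-edge⁻ {u} {w} e
      with uw , x≢u∧x≢w ← Equivalence.to (T-∧ {adj G u w}) e
      with x≢u , x≢w ← Equivalence.to (T-∧ {isNo (x ≟ u)}) x≢u∧x≢w
      = uw , toWitnessFalse x≢u , toWitnessFalse x≢w

    isolate-proper : ∀ {y} → Edge G x y → ProperSubgraph (isolate G x) G
    isolate-proper {y} xy = id , id , (λ _ _ → proj₁ ∘ isolate-edge⁻) ,
      λ (_ , reflects) → proj₁ (proj₂ (isolate-edge⁻ (reflects x y xy))) refl

    sqAdj-isolate : ∀ {a b} → x ≢ a → x ≢ b → ¬ Edge G x b → SqAdj G a b → SqAdj (isolate G x) a b
    sqAdj-isolate x≢a x≢b _ (a≢b , inj₁ ab) = a≢b , inj₁ (edge-isolate x≢a x≢b ab)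
    sqAdj-isolate x≢a x≢b x≁b (a≢b , inj₂ (m , am , mb)) =
      a≢b , inj₂ (m , edge-isolate x≢a x≢m am , edge-isolate x≢m x≢b mb)
      where
      x≢m : x ≢ _
      x≢m refl = x≁b mb

record Hexagon {n} (G : Graph n) : Set where
  field
    vertex    : Fin 6 → Fin n
    distinct  : Injective _≡_ _≡_ vertex
    edge      : ∀ k → Edge G (vertex k) (vertex (next k))

module _ {n} {G : Graph n} where

  cycle⇒hexagon : Cycle G 5 → Hexagon G
  cycle⇒hexagon C = record { vertex = vtx C ; distinct = injective C ; edge = edge }
    where
    edge : ∀ k → Edge G (vtx C k) (vtx C (next k))
    edge 0F = step C 0F
    edge 1F = step C 1F
    edge 2F = step C 2F
    edge 3F = step C 3F
    edge 4F = step C 4F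
    edge 5F = close C

  rotate : Hexagon G → Hexagon G
  rotate H = record
    { vertex = vertex ∘ next ; distinct = next-injective ∘ distinct ; edge = edge ∘ next }
    where open Hexagon H

  rotate-to : Hexagon G → Fin 6 → Hexagon G
  rotate-to H 0F = H
  rotate-to H 1F = rotate H
  rotate-to H 2F = rotate (rotate H)
  rotate-to H 3F = rotate (rotate (rotate H))
  rotate-to H 4F = rotate (rotate (rotate (rotate H)))
  rotate-to H 5F = rotate (rotate (rotate (rotate (rotate H))))

  rotate-to-vertex : ∀ H k → Hexagon.vertex (rotate-to H k) 0F ≡ Hexagon.vertex H k
  rotate-to-vertex H 0F = refl
  rotate-to-vertex H 1F = refl
  rotate-to-vertex H 2F = refl
  rotate-to-vertex H 3F = refl
  rotate-to-vertex H 4F = refl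
  rotate-to-vertex H 5F = refl

  module _ (girth : GirthAtLeast6 G) (H : Hexagon G) where
    open Hexagon H renaming (vertex to v)
    open GraphProperties G

    hexagon-antipodal : ∀ k → ¬ SqAdj G (v k) (v (antipode k))
    hexagon-antipodal k = path₃-¬sqAdj girth (≢-next² k ∘ distinct) (≢-next² (next k) ∘ distinct)
      (edge k) (edge (next k)) (edge (next (next k)))

    hexagon-sqAdj : ∀ i j → SqAdj G (v i) (v j) → Near i j ⊎ Near j i
    hexagon-sqAdj i j sq@(vi≢vj , _) = near-or-antipodal i j (vi≢vj ∘ cong v)
      λ { refl → hexagon-antipodal i sq }

module SecondNeighbourhood {n} (G : Graph n) {S : Fin n → Set} (S? : Decidable S) where
  open GraphProperties G

  reach : Fin n → List (Fin n)
  reach w = filter (¬? ∘ S?) (w ∷ neighbours w)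

  -- the vertices outside S at distance 1 or 2 from y, with repetitions
  ext : Fin n → List (Fin n)
  ext y = concatMap reach (neighbours y)

  ∈-ext : ∀ {y z} → ¬ S z → SqAdj G y z → z ∈ ext y
  ∈-ext ¬Sz (_ , inj₁ yz) =
    ∈-concat⁺′ (∈-filter⁺ (¬? ∘ S?) (here refl) ¬Sz) (∈-map⁺ reach (∈-neighbours yz))
  ∈-ext ¬Sz (_ , inj₂ (m , ym , mz)) =
    ∈-concat⁺′ (∈-filter⁺ (¬? ∘ S?) (there (∈-neighbours mz)) ¬Sz) (∈-map⁺ reach (∈-neighbours ym))

  ext-sqAdj : ∀ {y z} → S y → z ∈ ext y → ¬ S z × SqAdj G y z
  ext-sqAdj {y} Sy z∈ext
    with zs , z∈zs , zs∈ ← ∈-concat⁻′ (map reach (neighbours y)) z∈ext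
    with w , w∈ , refl ← ∈-map⁻ reach zs∈
    with ∈-filter⁻ (¬? ∘ S?) z∈zs
  ... | here refl , ¬Sz = ¬Sz , (λ { refl → ¬Sz Sy }) , inj₁ (neighbours⇒edge w∈)
  ... | there z∈nw , ¬Sz = ¬Sz , (λ { refl → ¬Sz Sy }) , inj₂ (w , neighbours⇒edge w∈ , neighbours⇒edge z∈nw)

  length-reach-inside : ∀ {p s t} → S p → S s → S t → s ≢ t → Edge G p s → Edge G p t →
                        length (reach p) + 2 ≤ deg G p
  length-reach-inside {p} Sp Ss St s≢t ps pt with rest , nbrs↭ ← neighbours-↭ ps pt s≢t = begin
    length (reach p) + 2  ≤⟨ +-monoˡ-≤ 2 (length-filter-↭ (¬? ∘ S?) (prep p nbrs↭)
                                (contradiction Sp ∷ contradiction Ss ∷ contradiction St ∷ [])) ⟩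
    length rest + 2       ≡⟨ +-comm (length rest) 2 ⟩
    2 + length rest       ≡⟨ ↭-length nbrs↭ ⟨
    deg G p               ∎
    where open ≤-Reasoning

  length-reach-boundary : ∀ {y w} → S y → Edge G w y → length (reach w) ≤ deg G w
  length-reach-boundary {y} {w} Sy wy with rest , nbrs↭ ← ∈⇒↭∷ (∈-neighbours wy) = begin
    length (reach w)   ≤⟨ length-filter-↭ (¬? ∘ S?) (↭-trans (prep w nbrs↭) (swap w y ↭-refl))
                                           (contradiction Sy ∷ []) ⟩
    suc (length rest)  ≡⟨ ↭-length nbrs↭ ⟨
    deg G w            ∎
    where open ≤-Reasoning

  length-ext : MaxDegreeAtMost G 3 → ∀ {y a b} → S y → Edge G y a → Edge G y b → a ≢ b →
               length (reach a) + 2 ≤ deg G a → length (reach b) + 2 ≤ deg G b →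
               10 + length (ext y) ≤ deg G a + deg G b + 3 * deg G y
  length-ext Δ≤3 {y} {a} {b} Sy ya yb a≢b ra≤ rb≤ with rest , nbrs↭ ← neighbours-↭ ya yb a≢b = begin
    10 + length (ext y)
      ≡⟨ cong (10 +_) (length-concatMap-↭ reach nbrs↭) ⟩
    10 + length (reach a ++ reach b ++ concatMap reach rest)
      ≡⟨ cong (10 +_) (trans (length-++ (reach a)) (cong (length (reach a) +_) (length-++ (reach b)))) ⟩
    10 + (length (reach a) + (length (reach b) + length (concatMap reach rest)))
      ≤⟨ +-monoʳ-≤ 10 (+-monoʳ-≤ (length (reach a)) (+-monoʳ-≤ (length (reach b)) rest≤)) ⟩
    10 + (length (reach a) + (length (reach b) + length rest * 3))
      ≡⟨ regroup (length (reach a)) (length (reach b)) (length rest) ⟩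
    (length (reach a) + 2) + (length (reach b) + 2) + 3 * (2 + length rest)
      ≤⟨ +-monoˡ-≤ (3 * (2 + length rest)) (+-mono-≤ ra≤ rb≤) ⟩
    deg G a + deg G b + 3 * (2 + length rest)
      ≡⟨ cong (λ d → deg G a + deg G b + 3 * d) (↭-length nbrs↭) ⟨
    deg G a + deg G b + 3 * deg G y ∎
    where
    open ≤-Reasoning
    rest≤ : length (concatMap reach rest) ≤ length rest * 3
    rest≤ = length-concatMap-≤ reach rest λ w∈rest →
      let yw = neighbours⇒edge (∈-resp-↭ (↭-sym nbrs↭) (there (there w∈rest)))
      in ≤-trans (length-reach-boundary Sy (edge-sym yw)) (Δ≤3 _)
    regroup : ∀ p q r → 10 + (p + (q + r * 3)) ≡ (p + 2) + (q + 2) + 3 * (2 + r)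
    regroup = solve 3 (λ p q r → con 10 :+ (p :+ (q :+ r :* con 3))
                              := (p :+ con 2) :+ (q :+ con 2) :+ con 3 :* (con 2 :+ r)) refl
      where open +-*-Solver

degrees-≤ : ∀ {da db dy A B Y s} → da ≤ A → db ≤ B → dy ≤ Y → da + db + 3 * dy + s ≤ A + B + 3 * Y + s
degrees-≤ {s = s} da≤ db≤ dy≤ = +-monoˡ-≤ s (+-mono-≤ (+-mono-≤ da≤ db≤) (*-monoʳ-≤ 3 dy≤))

module Reduction {n} (G : Graph n) (Δ≤3 : MaxDegreeAtMost G 3) (girth : GirthAtLeast6 G)
                 (H : Hexagon G) (deg₀≡2 : deg G (Hexagon.vertex H 0F) ≡ 2) where
  open Hexagon H renaming (vertex to v)
  open GraphProperties G
  open ListColouring ℕ._≟_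

  OnHexagon : Fin n → Set
  OnHexagon u = ∃ λ k → v k ≡ u

  onHexagon? : Decidable OnHexagon
  onHexagon? u = any? λ k → v k ≟ u

  open SecondNeighbourhood G onHexagon?

  v≢ : ∀ {i j} → i ≢ j → v i ≢ v j
  v≢ i≢j = i≢j ∘ distinct

  edge⁻ : ∀ k → Edge G (v k) (v (prev k))
  edge⁻ k = edge-sym (subst (Edge G (v (prev k)) ∘ v) (next-prev k) (edge (prev k)))

  v₀-neighbours : ∀ {z} → Edge G (v 0F) z → OnHexagon z
  v₀-neighbours v₀z with degree-2-neighbours deg₀≡2 (edge 0F) (edge⁻ 0F) (v≢ λ ()) v₀z
  ... | inj₁ z≡v₁ = 1F , ≡.sym z≡v₁
  ... | inj₂ z≡v₅ = 5F , ≡.sym z≡v₅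

  length-reach-hexagon : ∀ k → length (reach (v k)) + 2 ≤ deg G (v k)
  length-reach-hexagon k =
    length-reach-inside (k , refl) (prev k , refl) (next k , refl) (v≢ (prev≢next k)) (edge⁻ k) (edge k)

  length-ext-hexagon : ∀ k → 10 + length (ext (v k)) ≤ deg G (v (prev k)) + deg G (v (next k)) + 3 * deg G (v k)
  length-ext-hexagon k = length-ext Δ≤3 (k , refl) (edge⁻ k) (edge k) (v≢ (prev≢next k))
                           (length-reach-hexagon (prev k)) (length-reach-hexagon (next k))

  hexagon-colouring-proper : ∀ {A} (κ : HexagonColouring A) → let open HexagonColouring κ in
                             ∀ i j → SqAdj G (v i) (v j) → colour i ≢ colour j
  hexagon-colouring-proper record { colour≢next = c≢c∘next ; colour≢next² = c≢c∘next² } i j vi~vj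
    with hexagon-sqAdj girth H i j vi~vj
  ... | inj₁ (inj₁ refl) = c≢c∘next i
  ... | inj₁ (inj₂ refl) = c≢c∘next² i
  ... | inj₂ (inj₁ refl) = ≢-sym (c≢c∘next j)
  ... | inj₂ (inj₂ refl) = ≢-sym (c≢c∘next² j)

  module Recolouring (L : Fin n → List ℕ) (L-ok : ∀ u → Unique (L u) × 7 ≤ length (L u))
                     (φ : Fin n → ℕ) (φ∈L : ∀ u → φ u ∈ L u)
                     (φ-proper : ∀ a b → SqAdj (isolate G (v 0F)) a b → φ a ≢ φ b) where

    Available : Fin 6 → ℕ → Set
    Available k c = c ∈ L (v k) × c ∉ map φ (ext (v k))

    available-atLeast : ∀ k {s} → deg G (v (prev k)) + deg G (v (next k)) + 3 * deg G (v k) + s ≤ 17 →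
                        AtLeast s (Available k)
    available-atLeast k {s} bound = atLeast-∈∉ (map φ (ext (v k))) (proj₁ (L-ok (v k))) (begin
      length (map φ (ext (v k))) + s  ≡⟨ cong (_+ s) (length-map φ (ext (v k))) ⟩
      length (ext (v k)) + s          ≤⟨ +-cancelˡ-≤ 10 _ _ (≤-trans (≤-reflexive (≡.sym (+-assoc 10 _ s)))
                                           (≤-trans (+-monoˡ-≤ s (length-ext-hexagon k)) bound)) ⟩
      7                               ≤⟨ proj₂ (L-ok (v k)) ⟩
      length (L (v k))                ∎)
      where open ≤-Reasoning

    v₀≢ : ∀ {k} → k ≢ 0F → v 0F ≢ v k
    v₀≢ k≢0 = v≢ (k≢0 ∘ ≡.sym)

    φ-proper-outside : ∀ {a b} → v 0F ≢ a → ¬ OnHexagon b → SqAdj G a b → φ a ≢ φ b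
    φ-proper-outside v₀≢a b∉ a~b =
      φ-proper _ _ (sqAdj-isolate v₀≢a (λ { refl → b∉ (0F , refl) }) (b∉ ∘ v₀-neighbours) a~b)

    φ-available : ∀ k → k ≢ 0F → Available k (φ (v k))
    φ-available k k≢0 = φ∈L (v k) , λ φvk∈ →
      let z , z∈ext , φvk≡φz = ∈-map⁻ φ φvk∈
          z∉ , vk~z = ext-sqAdj (k , refl) z∈ext
      in φ-proper-outside (v₀≢ k≢0) z∉ vk~z φvk≡φz

    φ-next : ∀ k → k ≢ 0F → next k ≢ 0F → φ (v k) ≢ φ (v (next k))
    φ-next k k≢0 k+1≢0 = φ-proper _ _ (edge⇒≢ (edge k) , inj₁ (edge-isolate (v₀≢ k≢0) (v₀≢ k+1≢0) (edge k)))

    φ-next² : ∀ k → k ≢ 0F → next k ≢ 0F → next (next k) ≢ 0F → φ (v k) ≢ φ (v (next (next k)))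
    φ-next² k k≢0 k+1≢0 k+2≢0 = φ-proper _ _ (v≢ (≢-next² k) , inj₂ (v (next k) ,
      edge-isolate (v₀≢ k≢0) (v₀≢ k+1≢0) (edge k) , edge-isolate (v₀≢ k+1≢0) (v₀≢ k+2≢0) (edge (next k))))

    deg₀≤2 : deg G (v 0F) ≤ 2
    deg₀≤2 = ≤-reflexive deg₀≡2

    hexagon-colouring : HexagonColouring Available
    hexagon-colouring = colour-hexagon {A = Available}
      (available-atLeast 0F (degrees-≤ (Δ≤3 _) (Δ≤3 _) deg₀≤2))
      (available-atLeast 1F (degrees-≤ deg₀≤2 (Δ≤3 _) (Δ≤3 _)))
      (available-atLeast 2F (degrees-≤ (Δ≤3 _) (Δ≤3 _) (Δ≤3 _)))
      (available-atLeast 3F (degrees-≤ (Δ≤3 _) (Δ≤3 _) (Δ≤3 _)))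
      (available-atLeast 4F (degrees-≤ (Δ≤3 _) (Δ≤3 _) (Δ≤3 _)))
      (available-atLeast 5F (degrees-≤ (Δ≤3 _) deg₀≤2 (Δ≤3 _)))
      (φ ∘ v) φ-available φ-next φ-next²

    open HexagonColouring hexagon-colouring

    recolour : (u : Fin n) → Dec (OnHexagon u) → ℕ
    recolour u (yes (k , _)) = colour k
    recolour u (no _) = φ u

    recolour-∈ : ∀ u d → recolour u d ∈ L u
    recolour-∈ u (yes (k , refl)) = proj₁ (colour∈ k)
    recolour-∈ u (no _) = φ∈L u

    colour-proper-outside : ∀ k {z} → ¬ OnHexagon z → SqAdj G (v k) z → colour k ≢ φ z
    colour-proper-outside k z∉ vk~z colour≡φz =
      proj₂ (colour∈ k) (subst (_∈ map φ (ext (v k))) (≡.sym colour≡φz) (∈-map⁺ φ (∈-ext z∉ vk~z)))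

    recolour-proper : ∀ a b da db → SqAdj G a b → recolour a da ≢ recolour b db
    recolour-proper _ _ (yes (i , refl)) (yes (j , refl)) = hexagon-colouring-proper hexagon-colouring i j
    recolour-proper _ _ (yes (i , refl)) (no b∉) = colour-proper-outside i b∉
    recolour-proper _ _ (no a∉) (yes (j , refl)) a~b = ≢-sym (colour-proper-outside j a∉ (sqAdj-sym a~b))
    recolour-proper _ _ (no a∉) (no b∉) = φ-proper-outside (λ { refl → a∉ (0F , refl) }) b∉

    colouring : Σ (Fin n → ℕ) λ ψ → (∀ u → ψ u ∈ L u) × (∀ a b → SqAdj G a b → ψ a ≢ ψ b)
    colouring = (λ u → recolour u (onHexagon? u)) , (λ u → recolour-∈ u (onHexagon? u)) ,
                (λ a b → recolour-proper a b (onHexagon? a) (onHexagon? b))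

  square-choosable : SquareChoosable (isolate G (v 0F)) 7 → SquareChoosable G 7
  square-choosable choosable L L-ok with φ , φ∈L , φ-proper ← choosable L L-ok =
    Recolouring.colouring L L-ok φ φ∈L φ-proper

lemma5 : ∀ {n} (G : Graph n) →
    Planar G → MaxDegreeAtMost G 3 → GirthAtLeast6 G →
    ¬ SquareChoosable G 7 →
    (∀ {m} (H : Graph m) → ProperSubgraph H G → SquareChoosable H 7) →
    (C : Cycle G 5) → ∀ i → deg G (vtx C i) ≢ 2
lemma5 G _ Δ≤3 girth not-choosable minimal C i deg≡2 =
  not-choosable (square-choosable (minimal (isolate G (vertex 0F)) (isolate-proper (edge 0F))))
  where
  H : Hexagon G
  H = rotate-to (cycle⇒hexagon C) i
  open Hexagon H
  deg₀≡2 : deg G (vertex 0F) ≡ 2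
  deg₀≡2 = trans (cong (deg G) (rotate-to-vertex (cycle⇒hexagon C) i)) deg≡2
  open GraphProperties G using (isolate-proper)
  open Reduction G Δ≤3 girth H deg₀≡2 using (square-choosable)
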